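{- Let $\mathfrak{B}=(B,\land^\mathfrak{B},\top^\mathfrak{B},\{a^\mathfrak{B}:a\in\Sigma\})$ be a semilattice with operators (SLO). Let $\mathfrak{B}^*$ be its dual frame $({\mathcal F}(\mathfrak{B}),\{R_a:a\in\Sigma\})$ with canonical valuation $v$. Then: (i) The map $v:B\to{\mathcal P}({\mathcal F}(\mathfrak{B}))$ is an embedding of $\mathfrak{B}$ into the algebra $({\mathcal P}({\mathcal F}(\mathfrak{B})),\cap,\{R_a^{ -1}:a\in\Sigma\})$; here $R_a^{ -1}(X)=\{F:\exists G\in X\ FR_aG\}$. (ii) For all variable-free formulas $A,B$ of ${\mathcal L}_\Sigma$: $A\vdash B$ holds in $\mathfrak{B}$ if and only if $\mathfrak{B}^*,F\Vdash A\to B$ for every $F\in{\mathcal F}(\mathfrak{B})$.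
   Context: $\Sigma$ is a set of modality symbols. SLO: an SLO is a meet-semilattice $(B,\land^\mathfrak{B})$ with a top element $\top^\mathfrak{B}$, together with, for each $a\in\Sigma$, a monotone unary operator $a^\mathfrak{B}:B\to B$. Write $x\le_\mathfrak{B}y$ iff $x\land^\mathfrak{B} y=x$. Filters: a filter in $\mathfrak{B}$ is a nonempty $F\subseteq B$ such that (1) $x\le_\mathfrak{B}y$ and $x\in F$ imply $y\in F$, and (2) $x,y\in F$ imply $x\land^\mathfrak{B}y\in F$. ${\mathcal F}(\mathfrak{B})$ is the set of filters. Dual frame: for $F,G\in{\mathcal F}(\mathfrak{B})$, $FR_aG$ iff $a^\mathfrak{B}(x)\in F$ for all $x\in G$. The canonical valuation is $v(x)=\{F\in{\mathcal F}(\mathfrak{B}):x\in F\}$. Formulas: ${\mathcal L}_\Sigma$ is the strictly positive language. Its variable-free formulas are built from $\top$ by $\land$ and by the unary modalities $a\in\Sigma$. Such a formula $A$ is interpreted in $\mathfrak{B}$ as an element $A^\mathfrak{B}$ in the obvious way. "$A\vdash B$ holds in $\mathfrak{B}$" means $A^\mathfrak{B}\le_\mathfrak{B}B^\mathfrak{B}$. Forcing in $\mathfrak{B}^*$ is defined by: $F\Vdash\top$ always; $F\Vdash A\land B$ iff $F\Vdash A$ and $F\Vdash B$; $F\Vdash aA$ iff there is $G$ with $FR_aG$ and $G\Vdash A$. $F\Vdash A\to B$ means that $F\Vdash A$ implies $F\Vdash B$. -}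

module Defs where

open import Level using (Level; _⊔_; suc)
open import Data.Product using (Σ-syntax; _×_; _,_)
open import Function.Bundles using (_⇔_)
open import Relation.Binary.PropositionalEquality using (_≡_)

record SLO {s : Level} (Sig : Set s) (ℓ : Level) : Set (s ⊔ suc ℓ) where
  infixr 6 _∧_
  field
    Carrier : Set ℓ
    _∧_     : Carrier → Carrier → Carrier
    ⊤       : Carrier
    op      : Sig → Carrier → Carrier
    ∧-assoc : ∀ x y z → (x ∧ y) ∧ z ≡ x ∧ (y ∧ z)
    ∧-comm  : ∀ x y → x ∧ y ≡ y ∧ x
    ∧-idem  : ∀ x → x ∧ x ≡ x
    ∧-⊤     : ∀ x → x ∧ ⊤ ≡ x

  _≤_ : Carrier → Carrier → Set ℓ
  x ≤ y = x ∧ y ≡ x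

  field
    op-mono : ∀ a {x y} → x ≤ y → op a x ≤ op a y

module _ {s ℓ : Level} {Sig : Set s} (𝔅 : SLO Sig ℓ) where
  open SLO 𝔅

  record Filter : Set (suc ℓ) where
    field
      mem      : Carrier → Set ℓ
      nonempty : Σ[ x ∈ Carrier ] mem x
      up       : ∀ {x y} → x ≤ y → mem x → mem y
      meet     : ∀ {x y} → mem x → mem y → mem (x ∧ y)
  open Filter public

  R : Sig → Filter → Filter → Set ℓ
  R a F G = ∀ x → mem G x → mem F (op a x)

  v : Carrier → Filter → Set ℓ
  v x F = mem F x

  _∩_ : {p q : Level} → (Filter → Set p) → (Filter → Set q) → Filter → Set (p ⊔ q)
  (X ∩ Y) F = X F × Y F

  Rinv : {p : Level} → Sig → (Filter → Set p) → Filter → Set (suc ℓ ⊔ p)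
  Rinv a X F = Σ[ G ∈ Filter ] (X G × R a F G)

  _≐_ : {p q : Level} → (Filter → Set p) → (Filter → Set q) → Set (suc ℓ ⊔ p ⊔ q)
  X ≐ Y = ∀ F → X F ⇔ Y F

-- Variable-free strictly positive formulas.
data Fm {s : Level} (Sig : Set s) : Set s where
  ⊤ᶠ  : Fm Sig
  _∧ᶠ_ : Fm Sig → Fm Sig → Fm Sig
  ◇   : Sig → Fm Sig → Fm Sig

module _ {s ℓ : Level} {Sig : Set s} (𝔅 : SLO Sig ℓ) where
  open SLO 𝔅

  ⟦_⟧ : Fm Sig → Carrier
  ⟦ ⊤ᶠ ⟧ = ⊤
  ⟦ A ∧ᶠ B ⟧ = ⟦ A ⟧ ∧ ⟦ B ⟧
  ⟦ ◇ a A ⟧ = op a ⟦ A ⟧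

  Holds : Fm Sig → Fm Sig → Set ℓ
  Holds A B = ⟦ A ⟧ ≤ ⟦ B ⟧

  data _⊩_ (F : Filter 𝔅) : Fm Sig → Set (s ⊔ suc ℓ) where
    ⊩⊤ : F ⊩ ⊤ᶠ
    ⊩∧ : ∀ {A B} → F ⊩ A → F ⊩ B → F ⊩ (A ∧ᶠ B)
    ⊩◇ : ∀ {a A} (G : Filter 𝔅) → R 𝔅 a F G → G ⊩ A → F ⊩ ◇ a A

module Submission where

-- The proof rests on two facts about the canonical valuation v(x) = {F : x ∈ F}.
--   * Principal filters ↑x separate elements: x ≤ y iff y ∈ F whenever
--     x ∈ F, for every filter F (take F = ↑x). This gives injectivity of v and
--     reduces (ii) to a statement about membership in filters.
--   * a(x) ∈ F iff F R_a ↑x: the principal filter ↑x is a witness for every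
--     R_a-successor condition. This gives v(a x) = R_a⁻¹(v x) and the
--     ◇-case of the truth lemma  F ⊩ A ⇔ ⟦A⟧ ∈ F.

open import Defs
open import Level using (Level)
open import Data.Product using (_×_; _,_)
open import Function.Bundles using (_⇔_; mk⇔; Equivalence)
open import Relation.Binary.PropositionalEquality using (_≡_; sym; cong; module ≡-Reasoning)

module Representation {s ℓ : Level} {Sig : Set s} (𝔅 : SLO Sig ℓ) where
  open SLO 𝔅
  open ≡-Reasoning
  open Equivalence using (to; from)

  ≤-refl : ∀ {x} → x ≤ x
  ≤-refl {x} = ∧-idem x

  ≤-trans : ∀ {x y z} → x ≤ y → y ≤ z → x ≤ z
  ≤-trans {x} {y} {z} x≤y y≤z = begin
    x ∧ z        ≡⟨ cong (_∧ z) (sym x≤y) ⟩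
    (x ∧ y) ∧ z  ≡⟨ ∧-assoc x y z ⟩
    x ∧ (y ∧ z)  ≡⟨ cong (x ∧_) y≤z ⟩
    x ∧ y        ≡⟨ x≤y ⟩
    x            ∎

  ≤-antisym : ∀ {x y} → x ≤ y → y ≤ x → x ≡ y
  ≤-antisym {x} {y} x≤y y≤x = begin
    x      ≡⟨ sym x≤y ⟩
    x ∧ y  ≡⟨ ∧-comm x y ⟩
    y ∧ x  ≡⟨ y≤x ⟩
    y      ∎

  ≤-⊤ : ∀ {x} → x ≤ ⊤
  ≤-⊤ {x} = ∧-⊤ x

  ∧-greatest : ∀ {x y z} → x ≤ y → x ≤ z → x ≤ (y ∧ z)
  ∧-greatest {x} {y} {z} x≤y x≤z = begin
    x ∧ (y ∧ z)  ≡⟨ sym (∧-assoc x y z) ⟩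
    (x ∧ y) ∧ z  ≡⟨ cong (_∧ z) x≤y ⟩
    x ∧ z        ≡⟨ x≤z ⟩
    x            ∎

  ∧-lowerˡ : ∀ {x y} → (x ∧ y) ≤ x
  ∧-lowerˡ {x} {y} = begin
    (x ∧ y) ∧ x  ≡⟨ ∧-comm (x ∧ y) x ⟩
    x ∧ (x ∧ y)  ≡⟨ sym (∧-assoc x x y) ⟩
    (x ∧ x) ∧ y  ≡⟨ cong (_∧ y) (∧-idem x) ⟩
    x ∧ y        ∎

  ∧-lowerʳ : ∀ {x y} → (x ∧ y) ≤ y
  ∧-lowerʳ {x} {y} = begin
    (x ∧ y) ∧ y  ≡⟨ cong (_∧ y) (∧-comm x y) ⟩
    (y ∧ x) ∧ y  ≡⟨ ∧-lowerˡ ⟩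
    y ∧ x        ≡⟨ ∧-comm y x ⟩
    x ∧ y        ∎

  ⊤∈ : (F : Filter 𝔅) → mem F ⊤
  ⊤∈ F = let (x , x∈F) = nonempty F in up F ≤-⊤ x∈F

  ∧∈⇔ : (F : Filter 𝔅) (x y : Carrier) → mem F (x ∧ y) ⇔ (mem F x × mem F y)
  ∧∈⇔ F x y = mk⇔ (λ x∧y∈F → up F ∧-lowerˡ x∧y∈F , up F ∧-lowerʳ x∧y∈F)
                  (λ (x∈F , y∈F) → meet F x∈F y∈F)

  ↑ : Carrier → Filter 𝔅
  ↑ x = record
    { mem      = x ≤_
    ; nonempty = x , ≤-refl
    ; up       = λ y≤z x≤y → ≤-trans x≤y y≤z
    ; meet     = ∧-greatest
    }

  ≤⇔filter-inclusion : (x y : Carrier) → x ≤ y ⇔ ((F : Filter 𝔅) → mem F x → mem F y)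
  ≤⇔filter-inclusion x y = mk⇔ (λ x≤y F → up F x≤y) (λ incl → incl (↑ x) ≤-refl)

  R-↑⇔ : (a : Sig) (F : Filter 𝔅) (x : Carrier) → R 𝔅 a F (↑ x) ⇔ mem F (op a x)
  R-↑⇔ a F x = mk⇔ (λ F-R-↑x → F-R-↑x x ≤-refl)
                   (λ ax∈F y x≤y → up F (op-mono a x≤y) ax∈F)

  v-injective : (x y : Carrier) → _≐_ 𝔅 (v 𝔅 x) (v 𝔅 y) → x ≡ y
  v-injective x y v-x≐v-y = ≤-antisym
    (from (≤⇔filter-inclusion x y) (λ F → to (v-x≐v-y F)))
    (from (≤⇔filter-inclusion y x) (λ F → from (v-x≐v-y F)))

  v-∧ : (x y : Carrier) → _≐_ 𝔅 (v 𝔅 (x ∧ y)) (_∩_ 𝔅 (v 𝔅 x) (v 𝔅 y))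
  v-∧ x y F = ∧∈⇔ F x y

  v-op : (a : Sig) (x : Carrier) → _≐_ 𝔅 (v 𝔅 (op a x)) (Rinv 𝔅 a (v 𝔅 x))
  v-op a x F = mk⇔ (λ ax∈F → ↑ x , ≤-refl , from (R-↑⇔ a F x) ax∈F)
                   (λ (G , x∈G , F-R-G) → F-R-G x x∈G)

  v-⊤ : (F : Filter 𝔅) → v 𝔅 ⊤ F
  v-⊤ = ⊤∈

  -- Truth lemma: a filter forces a formula iff it contains its interpretation.
  -- In the ◇-case the principal filter ↑⟦A⟧ is the required successor.
  truth : (F : Filter 𝔅) (A : Fm Sig) → _⊩_ 𝔅 F A ⇔ mem F (⟦_⟧ 𝔅 A)
  truth F A = mk⇔ (forced⇒mem F A) (mem⇒forced F A)
    where
    forced⇒mem : (F : Filter 𝔅) (A : Fm Sig) → _⊩_ 𝔅 F A → mem F (⟦_⟧ 𝔅 A)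
    forced⇒mem F ⊤ᶠ       ⊩⊤              = ⊤∈ F
    forced⇒mem F (A ∧ᶠ B) (⊩∧ F⊩A F⊩B)    = meet F (forced⇒mem F A F⊩A) (forced⇒mem F B F⊩B)
    forced⇒mem F (◇ a A)  (⊩◇ G F-R-G G⊩A) = F-R-G (⟦_⟧ 𝔅 A) (forced⇒mem G A G⊩A)

    mem⇒forced : (F : Filter 𝔅) (A : Fm Sig) → mem F (⟦_⟧ 𝔅 A) → _⊩_ 𝔅 F A
    mem⇒forced F ⊤ᶠ       _ = ⊩⊤
    mem⇒forced F (A ∧ᶠ B) A∧B∈F =
      let (A∈F , B∈F) = to (∧∈⇔ F _ _) A∧B∈F
      in ⊩∧ (mem⇒forced F A A∈F) (mem⇒forced F B B∈F)
    mem⇒forced F (◇ a A)  ◇A∈F =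
      ⊩◇ (↑ (⟦_⟧ 𝔅 A)) (from (R-↑⇔ a F _) ◇A∈F) (mem⇒forced (↑ (⟦_⟧ 𝔅 A)) A ≤-refl)

  -- Part (ii): by the truth lemma, validity of A → B in the dual frame is
  -- inclusion of filters containing ⟦A⟧ in those containing ⟦B⟧.
  holds⇔valid : (A B : Fm Sig) → Holds 𝔅 A B ⇔ ((F : Filter 𝔅) → _⊩_ 𝔅 F A → _⊩_ 𝔅 F B)
  holds⇔valid A B = mk⇔
    (λ A≤B F F⊩A → from (truth F B) (to (≤⇔filter-inclusion _ _) A≤B F (to (truth F A) F⊩A)))
    (λ valid → from (≤⇔filter-inclusion _ _)
                    (λ F A∈F → to (truth F B) (valid F (from (truth F A) A∈F))))

mainTheorem1 : {s ℓ : Level} {Sig : Set s} (𝔅 : SLO Sig ℓ) →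
    (((x y : SLO.Carrier 𝔅) → _≐_ 𝔅 (v 𝔅 x) (v 𝔅 y) → x ≡ y)
     × ((x y : SLO.Carrier 𝔅) → _≐_ 𝔅 (v 𝔅 (SLO._∧_ 𝔅 x y)) (_∩_ 𝔅 (v 𝔅 x) (v 𝔅 y)))
     × ((a : Sig) (x : SLO.Carrier 𝔅) → _≐_ 𝔅 (v 𝔅 (SLO.op 𝔅 a x)) (Rinv 𝔅 a (v 𝔅 x)))
     × ((F : Filter 𝔅) → v 𝔅 (SLO.⊤ 𝔅) F))
    × ((A B : Fm Sig) → Holds 𝔅 A B ⇔ ((F : Filter 𝔅) → _⊩_ 𝔅 F A → _⊩_ 𝔅 F B))
mainTheorem1 𝔅 = (v-injective , v-∧ , v-op , v-⊤) , holds⇔valid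
  where open Representation 𝔅
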